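{- Let $G$ be a graph whose twin graph $G^*$ is isomorphic to the 5-cycle $C_5$ with one chord added, such that the two adjacent degree-2 vertices of $G^*$ (those not adjacent to both chord endpoints) are of type (1) and all other vertices of $G^*$ are of type (1K). Then $D(G)\neq n(G)-2$.
   Context: All graphs are finite and simple; $n(G)$ is the number of vertices. Two vertices $u,v$ are twins if $N_G(v)\setminus\{u\}=N_G(u)\setminus\{v\}$; the relation "$u=v$ or $u,v$ twins" is an equivalence relation with class $v^*$ of $v$. The twin graph $G^*$ has vertex set $\{v^*\}$ and edges $u^*v^*$ for $uv\in E(G)$. $v^*$ is of type (1) if $|v^*|=1$, of type (K) if it induces $K_r$ with $r\geq 2$, of type (N) if it induces the edgeless graph $\overline{K_r}$ with $r\geq 2$; type (1K) means (1) or (K). In $C_5$ with a chord, the chord endpoints have degree 3, one degree-2 vertex is adjacent to both chord endpoints, and the remaining two degree-2 vertices are adjacent to each other. $D(G)$ is the minimum number of colors in a vertex coloring preserved by no non-trivial automorphism of $G$. -}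

module Defs where

open import Data.Nat using (ℕ; _≤_)
open import Data.Fin using (Fin; zero; suc)
open import Data.Product using (Σ; ∃; _×_; _,_)
open import Data.Sum using (_⊎_)
open import Data.Empty using (⊥)
open import Relation.Nullary using (¬_; Dec)
open import Relation.Binary.PropositionalEquality using (_≡_; _≢_)
open import Function.Bundles using (_⇔_)

record Graph : Set₁ where
  field
    n     : ℕ
    _~_   : Fin n → Fin n → Set
    ~-sym : ∀ {u v} → u ~ v → v ~ u
    ~-irr : ∀ {u} → ¬ (u ~ u)
    ~-dec : ∀ u v → Dec (u ~ v)

open Graph public

Twins : (G : Graph) → Fin (n G) → Fin (n G) → Set
Twins G u v = ∀ w → w ≢ u → w ≢ v → (_~_ G v w ⇔ _~_ G u w)

-- The fixed graph H = C5 with one chord, on Fin 5: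
-- cycle 0-1-2-3-4-0 plus chord 0-2.
-- Chord endpoints 0,2 (degree 3); vertex 1 is adjacent to both chord endpoints;
-- vertices 3,4 are the two adjacent degree-2 vertices.
c0 c1 c2 c3 c4 : Fin 5
c0 = zero
c1 = suc zero
c2 = suc (suc zero)
c3 = suc (suc (suc zero))
c4 = suc (suc (suc (suc zero)))

data HEdge : Fin 5 → Fin 5 → Set where
  e01 : HEdge c0 c1
  e10 : HEdge c1 c0
  e12 : HEdge c1 c2
  e21 : HEdge c2 c1
  e23 : HEdge c2 c3
  e32 : HEdge c3 c2
  e34 : HEdge c3 c4
  e43 : HEdge c4 c3
  e40 : HEdge c4 c0
  e04 : HEdge c0 c4
  e02 : HEdge c0 c2
  e20 : HEdge c2 c0

-- π : V(G) → Fin 5 is the quotient map v ↦ v* composed with an isomorphism G* ≅ H.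
-- (Edges of G* join distinct classes; loops from edges inside a class are ignored.)
TwinGraphIso : (G : Graph) → (Fin (n G) → Fin 5) → Set
TwinGraphIso G π =
    (∀ i → ∃ λ v → π v ≡ i)
  × (∀ u v → (π u ≡ π v) ⇔ (u ≡ v ⊎ Twins G u v))
  × (∀ i j → i ≢ j →
       HEdge i j ⇔ (Σ (Fin (n G)) λ u → Σ (Fin (n G)) λ v → π u ≡ i × π v ≡ j × _~_ G u v))

Type1 : (G : Graph) → (Fin (n G) → Fin 5) → Fin 5 → Set
Type1 G π i = ∀ u v → π u ≡ i → π v ≡ i → u ≡ v

Type1K : (G : Graph) → (Fin (n G) → Fin 5) → Fin 5 → Set
Type1K G π i = ∀ u v → π u ≡ i → π v ≡ i → u ≢ v → _~_ G u v

record Aut (G : Graph) : Set where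
  field
    f     : Fin (n G) → Fin (n G)
    g     : Fin (n G) → Fin (n G)
    fg    : ∀ v → f (g v) ≡ v
    gf    : ∀ v → g (f v) ≡ v
    pres  : ∀ u v → _~_ G u v ⇔ _~_ G (f u) (f v)

open Aut public

NonTrivial : {G : Graph} → Aut G → Set
NonTrivial σ = ∃ λ v → f σ v ≢ v

Distinguishing : (G : Graph) (k : ℕ) → (Fin (n G) → Fin k) → Set
Distinguishing G k c = (σ : Aut G) → (∀ v → c (f σ v) ≡ c v) → ¬ NonTrivial σ

HasDistColouring : Graph → ℕ → Set
HasDistColouring G k = ∃ λ (c : Fin (n G) → Fin k) → Distinguishing G k c

IsDistNumber : Graph → ℕ → Set
IsDistNumber G k = HasDistColouring G k × (∀ j → HasDistColouring G j → k ≤ j)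

{-# OPTIONS --safe #-}
-- Choose representatives x₀, …, x₄ of the five twin classes. Colour x₀, x₁, x₃, x₄ alike and
-- every other vertex with a colour of its own; this uses n − 3 colours. An automorphism
-- preserving the colouring fixes every vertex outside S = {x₀, x₁, x₃, x₄} and permutes S.
-- Within S the vertices are told apart by their adjacencies to vertices already known to be
-- fixed: x₄ is the only one not adjacent to x₂, x₁ the only one adjacent to x₂ but not to x₄,
-- x₀ the only neighbour of x₁, and x₃ the only one adjacent to x₄ but not to x₁. Hence the
-- colouring is distinguishing and D(G) ≤ n − 3.
module Submission where

open import Defs
open import Level using (0ℓ)
open import Data.Nat using (ℕ; zero; suc; _∸_; _≰_)
open import Data.Nat.Properties using (1+n≰n)
open import Data.Fin using (Fin; punchOut; _≟_)
open import Data.Fin.Properties using (punchOut-injective)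
open import Data.Product using (Σ; _×_; _,_; proj₁; proj₂)
open import Data.Sum using (_⊎_; inj₁; inj₂; [_,_])
open import Data.Empty using (⊥-elim)
open import Function using (id; _∘_)
open import Relation.Nullary using (¬_; yes; no)
open import Relation.Unary using (Pred; _∈_; _∉_; _⊆_; _∪_; _⊢_; ｛_｝)
open import Relation.Binary.PropositionalEquality using (_≡_; _≢_; refl; sym; trans; cong; subst)
open import Function.Bundles using (_⇔_; mk⇔; Equivalence)
open Equivalence using (to; from)

InjectiveOutside : {A B : Set} → Pred A 0ℓ → (A → B) → Set
InjectiveOutside P c = ∀ u v → c u ≡ c v → u ≡ v ⊎ (u ∈ P × v ∈ P)

id-injectiveOutside : {A : Set} {P : Pred A 0ℓ} → InjectiveOutside P (id {A = A})
id-injectiveOutside u v u≡v = inj₁ u≡v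

injectiveOutside-mono : {A B : Set} {P Q : Pred A 0ℓ} {c : A → B} →
  P ⊆ Q → InjectiveOutside P c → InjectiveOutside Q c
injectiveOutside-mono P⊆Q c-inj u v e with c-inj u v e
... | inj₁ u≡v         = inj₁ u≡v
... | inj₂ (u∈P , v∈P) = inj₂ (P⊆Q u∈P , P⊆Q v∈P)

injectiveOutside-∘ : {A B C : Set} {P : Pred A 0ℓ} {Q : Pred B 0ℓ} {m : B → C} {c : A → B} →
  InjectiveOutside Q m → InjectiveOutside P c → InjectiveOutside (P ∪ c ⊢ Q) (m ∘ c)
injectiveOutside-∘ {c = c} m-inj c-inj u v e with m-inj (c u) (c v) e
... | inj₂ (cu∈Q , cv∈Q) = inj₂ (inj₂ cu∈Q , inj₂ cv∈Q)
... | inj₁ cu≡cv with c-inj u v cu≡cv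
...   | inj₁ u≡v         = inj₁ u≡v
...   | inj₂ (u∈P , v∈P) = inj₂ (inj₁ u∈P , inj₁ v∈P)

glue : ∀ {K} (p q : Fin K) → p ≢ q → Fin K → Fin (K ∸ 1)
glue {suc _} p q p≢q v with v ≟ q
... | yes _  = punchOut (p≢q ∘ sym)
... | no v≢q = punchOut (v≢q ∘ sym)

glue-injectiveOutside : ∀ {K} (p q : Fin K) (p≢q : p ≢ q) →
  InjectiveOutside (｛ p ｝ ∪ ｛ q ｝) (glue p q p≢q)
glue-injectiveOutside {suc _} p q p≢q u v e with u ≟ q | v ≟ q
... | yes u≡q | yes v≡q = inj₁ (trans u≡q (sym v≡q))
... | yes u≡q | no v≢q  =
  inj₂ (inj₂ (sym u≡q) , inj₁ (punchOut-injective (p≢q ∘ sym) (v≢q ∘ sym) e))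
... | no u≢q  | yes v≡q =
  inj₂ (inj₁ (punchOut-injective (p≢q ∘ sym) (u≢q ∘ sym) (sym e)) , inj₂ (sym v≡q))
... | no u≢q  | no v≢q  = inj₁ (punchOut-injective (u≢q ∘ sym) (v≢q ∘ sym) e)

module Merge {A : Set} {K : ℕ} {P : Pred A 0ℓ} {c : A → Fin K} (c-inj : InjectiveOutside P c)
             {p q : A} (p∉P : p ∉ P) (q∈P : q ∈ P) where

  separated : c p ≢ c q
  separated e with c-inj p q e
  ... | inj₁ refl      = p∉P q∈P
  ... | inj₂ (p∈P , _) = p∉P p∈P

  merge : A → Fin (K ∸ 1)
  merge = glue (c p) (c q) separated ∘ c

  merge-injectiveOutside : InjectiveOutside (P ∪ ｛ p ｝) merge
  merge-injectiveOutside =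
    injectiveOutside-mono glued⊆ (injectiveOutside-∘ (glue-injectiveOutside _ _ separated) c-inj)
    where
    glued⊆ : P ∪ c ⊢ (｛ c p ｝ ∪ ｛ c q ｝) ⊆ P ∪ ｛ p ｝
    glued⊆ (inj₁ x∈P) = inj₁ x∈P
    glued⊆ {x} (inj₂ (inj₁ cp≡cx)) with c-inj p x cp≡cx
    ... | inj₁ p≡x       = inj₂ p≡x
    ... | inj₂ (_ , x∈P) = inj₁ x∈P
    glued⊆ {x} (inj₂ (inj₂ cq≡cx)) with c-inj q x cq≡cx
    ... | inj₁ refl      = inj₁ q∈P
    ... | inj₂ (_ , x∈P) = inj₁ x∈P

module _ {A B : Set} {P : Pred A 0ℓ} {c : A → B} (c-inj : InjectiveOutside P c)
         {h : A → A} (h-preserves : ∀ v → c (h v) ≡ c v) where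

  preserving-fixes-outside : ∀ {v} → v ∉ P → h v ≡ v
  preserving-fixes-outside {v} v∉P with c-inj (h v) v (h-preserves v)
  ... | inj₁ hv≡v      = hv≡v
  ... | inj₂ (_ , v∈P) = ⊥-elim (v∉P v∈P)

  preserving-maps-into : ∀ {v} → v ∈ P → h v ∈ P
  preserving-maps-into {v} v∈P with c-inj (h v) v (h-preserves v)
  ... | inj₁ hv≡v       = subst (_∈ P) (sym hv≡v) v∈P
  ... | inj₂ (hv∈P , _) = hv∈P

  preserving-fixes-all : (∀ {v} → v ∈ P → h v ≡ v) → ∀ v → h v ≡ v
  preserving-fixes-all fixes-P v with c-inj (h v) v (h-preserves v)
  ... | inj₁ hv≡v      = hv≡v
  ... | inj₂ (_ , v∈P) = fixes-P v∈P

fixes-unique : ∀ {A : Set} (h : A → A) {S Φ : Pred A 0ℓ} {v : A} →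
  (∀ {s} → s ∈ S → h s ∈ S) → (∀ {s} → s ∈ Φ → h s ∈ Φ) →
  (∀ {s} → s ∈ S → s ∈ Φ → s ≡ v) → v ∈ S → v ∈ Φ → h v ≡ v
fixes-unique h hS hΦ unique v∈S v∈Φ = unique (hS v∈S) (hΦ v∈Φ)

fixed-adjacency : ∀ {G : Graph} (σ : Aut G) {w s : Fin (n G)} →
  f σ w ≡ w → _~_ G w s ⇔ _~_ G w (f σ s)
fixed-adjacency {G} σ {w} {s} σw≡w = mk⇔
  (λ a → subst (λ z → _~_ G z (f σ s)) σw≡w (to (pres σ w s) a))
  (λ a → from (pres σ w s) (subst (λ z → _~_ G z (f σ s)) (sym σw≡w) a))

HEdge-irrefl : ∀ {i} → ¬ HEdge i i
HEdge-irrefl ()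

module ChordedC5 (G : Graph) (π : Fin (n G) → Fin 5) (iso : TwinGraphIso G π) where

  V : Set
  V = Fin (n G)

  _≈_ : V → V → Set
  _≈_ = _~_ G

  rep : Fin 5 → V
  rep i = proj₁ (proj₁ iso i)

  π-rep : ∀ i → π (rep i) ≡ i
  π-rep i = proj₂ (proj₁ iso i)

  same-class⇔twins : ∀ u v → π u ≡ π v ⇔ (u ≡ v ⊎ Twins G u v)
  same-class⇔twins = proj₁ (proj₂ iso)

  HEdge⇔edge : ∀ i j → i ≢ j → HEdge i j ⇔ (Σ V λ u → Σ V λ v → π u ≡ i × π v ≡ j × u ≈ v)
  HEdge⇔edge = proj₂ (proj₂ iso)

  twins-adjacent : ∀ {u u' v} → π u ≡ π u' → π v ≢ π u → u' ≈ v → u ≈ v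
  twins-adjacent {u} {u'} {v} πu≡πu' πv≢πu a with to (same-class⇔twins u u') πu≡πu'
  ... | inj₁ refl = a
  ... | inj₂ tw   = to (tw v v≢u v≢u') a
    where
    v≢u : v ≢ u
    v≢u = πv≢πu ∘ cong π
    v≢u' : v ≢ u'
    v≢u' v≡u' = πv≢πu (trans (cong π v≡u') (sym πu≡πu'))

  adjacent⇔HEdge : ∀ {u v i j} → π u ≡ i → π v ≡ j → i ≢ j → u ≈ v ⇔ HEdge i j
  adjacent⇔HEdge {u} {v} {i} {j} refl refl i≢j = mk⇔
    (λ a → from (HEdge⇔edge i j i≢j) (u , v , refl , refl , a))
    (λ h → adjacent (to (HEdge⇔edge i j i≢j) h))
    where
    adjacent : (Σ V λ u' → Σ V λ v' → π u' ≡ i × π v' ≡ j × u' ≈ v') → u ≈ v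
    adjacent (u' , v' , πu'≡i , πv'≡j , a) =
      ~-sym G (twins-adjacent (sym πv'≡j) i≢j
        (~-sym G (twins-adjacent (sym πu'≡i) (λ e → i≢j (trans (sym e) πv'≡j)) a)))

  rep-distinct : ∀ {i j} → i ≢ j → rep i ≢ rep j
  rep-distinct {i} {j} i≢j e = i≢j (trans (sym (π-rep i)) (trans (cong π e) (π-rep j)))

  edge : ∀ {i j} → HEdge i j → rep i ≈ rep j
  edge {i} {j} h = from (adjacent⇔HEdge (π-rep i) (π-rep j) i≢j) h
    where
    i≢j : i ≢ j
    i≢j refl = HEdge-irrefl h

  nonEdge : ∀ {i j} → i ≢ j → ¬ HEdge i j → ¬ rep i ≈ rep j
  nonEdge {i} {j} i≢j ¬h = ¬h ∘ to (adjacent⇔HEdge (π-rep i) (π-rep j) i≢j)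

  x₀ x₁ x₂ x₃ x₄ : V
  x₀ = rep c0
  x₁ = rep c1
  x₂ = rep c2
  x₃ = rep c3
  x₄ = rep c4

  S : Pred V 0ℓ
  S = ((｛ x₃ ｝ ∪ ｛ x₀ ｝) ∪ ｛ x₁ ｝) ∪ ｛ x₄ ｝

  x₂∉S : x₂ ∉ S
  x₂∉S =
    [ [ [ rep-distinct (λ ()) , rep-distinct (λ ()) ] , rep-distinct (λ ()) ] , rep-distinct (λ ()) ]

  private
    module M₀ = Merge (id-injectiveOutside {P = ｛ x₃ ｝}) {x₀} (rep-distinct (λ ())) refl
    module M₁ = Merge M₀.merge-injectiveOutside {x₁}
      [ rep-distinct (λ ()) , rep-distinct (λ ()) ] (inj₁ refl)
    module M₂ = Merge M₁.merge-injectiveOutside {x₄}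
      [ [ rep-distinct (λ ()) , rep-distinct (λ ()) ] , rep-distinct (λ ()) ] (inj₁ (inj₁ refl))

  colouring : V → Fin (n G ∸ 1 ∸ 1 ∸ 1)
  colouring = M₂.merge

  colouring-injectiveOutside : InjectiveOutside S colouring
  colouring-injectiveOutside = M₂.merge-injectiveOutside

  module Rigidity (σ : Aut G) (σ-preserves : ∀ v → colouring (f σ v) ≡ colouring v) where

    maps-S : ∀ {s} → s ∈ S → f σ s ∈ S
    maps-S = preserving-maps-into colouring-injectiveOutside σ-preserves

    keeps-adjacent : ∀ {w s} → f σ w ≡ w → w ≈ s → w ≈ f σ s
    keeps-adjacent σw≡w = to (fixed-adjacency σ σw≡w)

    keeps-nonadjacent : ∀ {w s} → f σ w ≡ w → ¬ w ≈ s → ¬ w ≈ f σ s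
    keeps-nonadjacent σw≡w ¬a = ¬a ∘ from (fixed-adjacency σ σw≡w)

    fixes-x₂ : f σ x₂ ≡ x₂
    fixes-x₂ = preserving-fixes-outside colouring-injectiveOutside σ-preserves x₂∉S

    fixes-x₄ : f σ x₄ ≡ x₄
    fixes-x₄ = fixes-unique (f σ) maps-S (keeps-nonadjacent fixes-x₂)
      unique (inj₂ refl) (nonEdge (λ ()) (λ ()))
      where
      unique : ∀ {s} → s ∈ S → ¬ x₂ ≈ s → s ≡ x₄
      unique (inj₁ (inj₁ (inj₁ refl))) ¬a = ⊥-elim (¬a (edge e23))
      unique (inj₁ (inj₁ (inj₂ refl))) ¬a = ⊥-elim (¬a (edge e20))
      unique (inj₁ (inj₂ refl))        ¬a = ⊥-elim (¬a (edge e21))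
      unique (inj₂ refl)               _  = refl

    fixes-x₁ : f σ x₁ ≡ x₁
    fixes-x₁ = fixes-unique (f σ) maps-S
      (λ (a , ¬b) → keeps-adjacent fixes-x₂ a , keeps-nonadjacent fixes-x₄ ¬b)
      unique (inj₁ (inj₂ refl)) (edge e21 , nonEdge (λ ()) (λ ()))
      where
      unique : ∀ {s} → s ∈ S → x₂ ≈ s × ¬ x₄ ≈ s → s ≡ x₁
      unique (inj₁ (inj₁ (inj₁ refl))) (_ , ¬b) = ⊥-elim (¬b (edge e43))
      unique (inj₁ (inj₁ (inj₂ refl))) (_ , ¬b) = ⊥-elim (¬b (edge e40))
      unique (inj₁ (inj₂ refl))        _        = refl
      unique (inj₂ refl)               (a , _)  = ⊥-elim (nonEdge (λ ()) (λ ()) a)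

    fixes-x₀ : f σ x₀ ≡ x₀
    fixes-x₀ = fixes-unique (f σ) maps-S (keeps-adjacent fixes-x₁)
      unique (inj₁ (inj₁ (inj₂ refl))) (edge e10)
      where
      unique : ∀ {s} → s ∈ S → x₁ ≈ s → s ≡ x₀
      unique (inj₁ (inj₁ (inj₁ refl))) a = ⊥-elim (nonEdge (λ ()) (λ ()) a)
      unique (inj₁ (inj₁ (inj₂ refl))) _ = refl
      unique (inj₁ (inj₂ refl))        a = ⊥-elim (~-irr G a)
      unique (inj₂ refl)               a = ⊥-elim (nonEdge (λ ()) (λ ()) a)

    fixes-x₃ : f σ x₃ ≡ x₃
    fixes-x₃ = fixes-unique (f σ) maps-S
      (λ (a , ¬b) → keeps-adjacent fixes-x₄ a , keeps-nonadjacent fixes-x₁ ¬b)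
      unique (inj₁ (inj₁ (inj₁ refl))) (edge e43 , nonEdge (λ ()) (λ ()))
      where
      unique : ∀ {s} → s ∈ S → x₄ ≈ s × ¬ x₁ ≈ s → s ≡ x₃
      unique (inj₁ (inj₁ (inj₁ refl))) _        = refl
      unique (inj₁ (inj₁ (inj₂ refl))) (_ , ¬b) = ⊥-elim (¬b (edge e10))
      unique (inj₁ (inj₂ refl))        (a , _)  = ⊥-elim (nonEdge (λ ()) (λ ()) a)
      unique (inj₂ refl)               (a , _)  = ⊥-elim (~-irr G a)

    fixes-S : ∀ {s} → s ∈ S → f σ s ≡ s
    fixes-S (inj₁ (inj₁ (inj₁ refl))) = fixes-x₃
    fixes-S (inj₁ (inj₁ (inj₂ refl))) = fixes-x₀
    fixes-S (inj₁ (inj₂ refl))        = fixes-x₁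
    fixes-S (inj₂ refl)               = fixes-x₄

  colouring-distinguishing : Distinguishing G _ colouring
  colouring-distinguishing σ σ-preserves (v , σv≢v) =
    σv≢v (preserving-fixes-all colouring-injectiveOutside σ-preserves
      (Rigidity.fixes-S σ σ-preserves) v)

m∸2≰m∸1∸1∸1 : ∀ m → Fin (m ∸ 1 ∸ 1 ∸ 1) → m ∸ 2 ≰ m ∸ 1 ∸ 1 ∸ 1
m∸2≰m∸1∸1∸1 zero                ()
m∸2≰m∸1∸1∸1 (suc zero)          ()
m∸2≰m∸1∸1∸1 (suc (suc zero))    ()
m∸2≰m∸1∸1∸1 (suc (suc (suc _))) _ = 1+n≰n

lemma4p9 : (G : Graph) (π : Fin (n G) → Fin 5) →
    TwinGraphIso G π →
    Type1 G π c3 → Type1 G π c4 →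
    Type1K G π c0 → Type1K G π c1 → Type1K G π c2 →
    ¬ IsDistNumber G (n G ∸ 2)
lemma4p9 G π iso _ _ _ _ _ (_ , minimal) =
  m∸2≰m∸1∸1∸1 (n G) (colouring x₃) (minimal _ (colouring , colouring-distinguishing))
  where open ChordedC5 G π iso
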